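{- Define $g:\mathbb{N}\to\mathbb{Z}$ by $g(n)=(-1)^{n}\sum_{d\mid n}(-1)^{d}d^{3}$. Then $g$ is a multiplicative arithmetic function, i.e. $g(mn)=g(m)g(n)$ whenever $\gcd(m,n)=1$.
   Context: The sum runs over the positive divisors $d$ of $n$. -}

module Defs where

open import Data.Nat using (ℕ; zero; suc)
open import Data.Nat.Divisibility using (_∣?_)
open import Data.List using (List; filter; map; foldr; upTo)
open import Data.Integer using (ℤ; +_; _+_; _*_; _^_)
open import Data.Integer.Base using (-1ℤ)

divisors : ℕ → List ℕ
divisors n = filter (_∣? n) (map suc (upTo n))

sumℤ : List ℤ → ℤ
sumℤ = foldr _+_ (+ 0)

sgn : ℕ → ℤ
sgn k = -1ℤ ^ k

g : ℕ → ℤ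
g n = sgn n * sumℤ (map (λ d → sgn d * (+ d) ^ 3) (divisors n))

-- Put ε k = -(-1)^k, which is 1 for odd and -1 for even k. The two sign changes cancel, so
-- g n = ε n · Σ_{d ∣ n} ε d d³. Unlike (-1)^k, ε is multiplicative, because coprime m and n are
-- not both even; hence so is d ↦ ε d d³, and so is its divisor sum: for coprime m and n,
-- (a , b) ↦ a b is a bijection from pairs of divisors of m and of n onto the divisors of m n.
module Submission where

open import Defs
open import Data.Nat using (ℕ; NonZero) renaming (_*_ to _*ℕ_)
open import Data.Nat.Coprimality using (Coprime)
open import Data.Integer using (_*_)
open import Relation.Binary.PropositionalEquality using (_≡_)

open import Algebra.Bundles using (CommutativeMonoid)
open import Data.Empty using (⊥)
open import Data.Integer using (ℤ; +_; -_; _+_; _^_; -1ℤ; 1ℤ)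
import Data.Integer.Properties as ℤ
open import Data.Integer.Tactic.RingSolver using (solve-∀)
open import Data.List using (List; []; _∷_; _++_; map; upTo; cartesianProductWith)
open import Data.List.Properties using (map-++; map-∘)
open import Data.List.Membership.Propositional using (_∈_)
open import Data.List.Membership.Propositional.Properties
  using (∈-map⁻; ∈-map⁺; ∈-filter⁻; ∈-filter⁺; ∈-upTo⁺; ∈-cartesianProductWith⁺; ∈-cartesianProductWith⁻)
open import Data.List.Membership.Propositional.Properties.WithK using (unique∧set⇒bag)
open import Data.List.Relation.Binary.BagAndSetEquality using (∼bag⇒↭)
open import Data.List.Relation.Binary.Permutation.Propositional using (_↭_; ↭⇒↭ₛ)
import Data.List.Relation.Binary.Permutation.Propositional.Properties as Perm
open import Data.List.Relation.Binary.Permutation.Setoid.Properties using (foldr-commMonoid)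
import Data.List.Relation.Unary.All as All
import Data.List.Relation.Unary.All.Properties as All
open import Data.List.Relation.Unary.AllPairs using ([]; _∷_)
open import Data.List.Relation.Unary.Any using (here; there)
open import Data.List.Relation.Unary.Unique.Propositional using (Unique)
import Data.List.Relation.Unary.Unique.Propositional.Properties as Unique
open import Data.Nat using (zero; suc; ≢-nonZero; ≢-nonZero⁻¹; parity)
import Data.Nat.Properties as ℕ
open import Data.Nat.Coprimality as Coprimality using (coprime-divisor; coprime-/gcd)
open import Data.Nat.Divisibility
  using (_∣_; _∣?_; ∣⇒≤; ∣-trans; ∣-antisym; ∣-refl; _∣0; 0∣⇒≡0; ∣m∣n⇒∣m+n; m∣m*n; *-pres-∣; m∣n*o⇒m/n∣o)
open import Data.Nat.DivMod using (_/_; m/n*n≡m; m*[n/m]≡n)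
open import Data.Nat.GCD using (gcd; gcd[m,n]∣m; gcd[m,n]∣n; gcd[m,n]≢0)
open import Data.Parity using (Parity; 0ℙ; 1ℙ) renaming (_*_ to _*ℙ_)
import Data.Parity.Properties as Parity
open import Data.Product using (∃₂; _×_; _,_; proj₁; proj₂)
open import Data.Sum using (_⊎_; inj₁; inj₂)
open import Function using (_∘_)
open import Function.Bundles using (mk⇔)
open import Relation.Binary.PropositionalEquality
  using (refl; sym; trans; cong; cong₂; subst; module ≡-Reasoning)
open import Relation.Nullary using (contradiction)

open import Algebra.Properties.CommutativeSemigroup ℕ.*-commutativeSemigroup using (xy∙z≈xz∙y)
open import Algebra.Properties.CommutativeSemigroup ℤ.*-commutativeSemigroup using (interchange)
open import Algebra.Properties.CommutativeSemiring.Exp ℤ.+-*-commutativeSemiring using (^-distrib-*)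

private
  variable
    A B C : Set
    a a′ b b′ d m n : ℕ
    xs : List A
    ys : List B

sumℤ-++ : (xs ys : List ℤ) → sumℤ (xs ++ ys) ≡ sumℤ xs + sumℤ ys
sumℤ-++ []       ys = sym (ℤ.+-identityˡ (sumℤ ys))
sumℤ-++ (x ∷ xs) ys = trans (cong (_+_ x) (sumℤ-++ xs ys)) (sym (ℤ.+-assoc x (sumℤ xs) (sumℤ ys)))

sumℤ-↭ : {xs ys : List ℤ} → xs ↭ ys → sumℤ xs ≡ sumℤ ys
sumℤ-↭ p = foldr-commMonoid setoid isCommutativeMonoid (↭⇒↭ₛ p)
  where open CommutativeMonoid ℤ.+-0-commutativeMonoid

sumℤ-map-*ˡ : ∀ (F G : A → ℤ) c xs → (∀ {x} → x ∈ xs → F x ≡ c * G x) →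
  sumℤ (map F xs) ≡ c * sumℤ (map G xs)
sumℤ-map-*ˡ F G c []       _  = sym (ℤ.*-zeroʳ c)
sumℤ-map-*ˡ F G c (x ∷ xs) eq = begin
  F x + sumℤ (map F xs)          ≡⟨ cong₂ _+_ (eq (here refl)) (sumℤ-map-*ˡ F G c xs (eq ∘ there)) ⟩
  c * G x + c * sumℤ (map G xs)  ≡⟨ ℤ.*-distribˡ-+ c (G x) (sumℤ (map G xs)) ⟨
  c * (G x + sumℤ (map G xs))    ∎
  where open ≡-Reasoning

sumℤ-cartesianProductWith : ∀ (f : A → B → C) (F : C → ℤ) (G : A → ℤ) (H : B → ℤ) xs ys →
  (∀ {x y} → x ∈ xs → y ∈ ys → F (f x y) ≡ G x * H y) →
  sumℤ (map F (cartesianProductWith f xs ys)) ≡ sumℤ (map G xs) * sumℤ (map H ys)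
sumℤ-cartesianProductWith f F G H []       ys eq = refl
sumℤ-cartesianProductWith f F G H (x ∷ xs) ys eq = begin
  sumℤ (map F (map (f x) ys ++ rest))
    ≡⟨ cong sumℤ (map-++ F (map (f x) ys) rest) ⟩
  sumℤ (map F (map (f x) ys) ++ map F rest)
    ≡⟨ sumℤ-++ (map F (map (f x) ys)) (map F rest) ⟩
  sumℤ (map F (map (f x) ys)) + sumℤ (map F rest)
    ≡⟨ cong₂ _+_ (trans (cong sumℤ (sym (map-∘ ys))) (sumℤ-map-*ˡ (F ∘ f x) H (G x) ys (eq (here refl))))
                 (sumℤ-cartesianProductWith f F G H xs ys (eq ∘ there)) ⟩
  G x * ΣH + sumℤ (map G xs) * ΣH
    ≡⟨ ℤ.*-distribʳ-+ ΣH (G x) (sumℤ (map G xs)) ⟨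
  (G x + sumℤ (map G xs)) * ΣH ∎
  where
  open ≡-Reasoning
  rest = cartesianProductWith f xs ys
  ΣH = sumℤ (map H ys)

Unique-map⁺-∈ : {f : A → B} → (∀ {x y} → x ∈ xs → y ∈ xs → f x ≡ f y → x ≡ y) →
  Unique xs → Unique (map f xs)
Unique-map⁺-∈ inj []            = []
Unique-map⁺-∈ inj (x∉xs ∷ xs!) =
  All.map⁺ (All.tabulate λ y∈xs → All.lookup x∉xs y∈xs ∘ inj (here refl) (there y∈xs))
  ∷ Unique-map⁺-∈ (λ x∈ y∈ → inj (there x∈) (there y∈)) xs!

Unique-cartesianProductWith⁺-∈ : (f : A → B → C) →
  (∀ {x x′ y y′} → x ∈ xs → x′ ∈ xs → y ∈ ys → y′ ∈ ys → f x y ≡ f x′ y′ → x ≡ x′ × y ≡ y′) →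
  Unique xs → Unique ys → Unique (cartesianProductWith f xs ys)
Unique-cartesianProductWith⁺-∈ f inj []           ys! = []
Unique-cartesianProductWith⁺-∈ {xs = x ∷ xs} {ys = ys} f inj (x∉xs ∷ xs!) ys! =
  Unique.++⁺ (Unique-map⁺-∈ (λ y∈ y′∈ → proj₂ ∘ inj (here refl) (here refl) y∈ y′∈) ys!)
             (Unique-cartesianProductWith⁺-∈ f (λ x∈ x′∈ → inj (there x∈) (there x′∈)) xs! ys!)
             disjoint
  where
  disjoint : ∀ {v} → v ∈ map (f x) ys × v ∈ cartesianProductWith f xs ys → ⊥
  disjoint (v∈map , v∈rest)
    with y , y∈ , refl ← ∈-map⁻ (f x) v∈map
    with x′ , y′ , x′∈ , y′∈ , eq ← ∈-cartesianProductWith⁻ f xs ys v∈rest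
    = All.lookup x∉xs x′∈ (proj₁ (inj (here refl) (there x′∈) y∈ y′∈ eq))

∈-divisors⁻ : ∀ n → d ∈ divisors n → d ∣ n × NonZero d
∈-divisors⁻ n d∈ with d∈upTo , d∣n ← ∈-filter⁻ (_∣? n) {xs = map suc (upTo n)} d∈
  with _ , _ , refl ← ∈-map⁻ suc d∈upTo = d∣n , _

∈-divisors⁺ : ∀ n .{{_ : NonZero n}} → d ∣ n → d ∈ divisors n
∈-divisors⁺ {zero}  n 0∣n = contradiction (0∣⇒≡0 0∣n) (≢-nonZero⁻¹ n)
∈-divisors⁺ {suc d} n d∣n = ∈-filter⁺ (_∣? n) (∈-map⁺ suc (∈-upTo⁺ (∣⇒≤ d∣n))) d∣n

divisors-unique : ∀ n → Unique (divisors n)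
divisors-unique n = Unique.filter⁺ (_∣? n) (Unique.map⁺ ℕ.suc-injective (Unique.upTo⁺ n))

coprime-∣ : Coprime m n → a ∣ m → b ∣ n → Coprime a b
coprime-∣ coprime a∣m b∣n (k∣a , k∣b) = coprime (∣-trans k∣a a∣m , ∣-trans k∣b b∣n)

-- Take a = gcd d m: the cofactor d / a divides (m / a) * n and is coprime to m / a.
∣*-split : .{{NonZero m}} → d ∣ m *ℕ n → ∃₂ λ a b → a ∣ m × b ∣ n × d ≡ a *ℕ b
∣*-split {m} {d} {n} d∣mn = k , d / k , k∣m , d/k∣n , sym (m*[n/m]≡n k∣d)
  where
  k = gcd d m
  k∣d = gcd[m,n]∣m d m
  k∣m = gcd[m,n]∣n d m
  instance
    k≢0 : NonZero k
    k≢0 = ≢-nonZero (gcd[m,n]≢0 d m (inj₂ (≢-nonZero⁻¹ m)))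
  mn≡[m/k]nk : m *ℕ n ≡ (m / k) *ℕ n *ℕ k
  mn≡[m/k]nk = trans (cong (_*ℕ n) (sym (m/n*n≡m k∣m))) (xy∙z≈xz∙y (m / k) k n)
  d/k∣n : d / k ∣ n
  d/k∣n = coprime-divisor (coprime-/gcd d m) (m∣n*o⇒m/n∣o k∣d (subst (d ∣_) mn≡[m/k]nk d∣mn))

coprime-factorisation-uniqueˡ : Coprime m n → a ∣ m → a′ ∣ m → b ∣ n → b′ ∣ n →
  a *ℕ b ≡ a′ *ℕ b′ → a ≡ a′
coprime-factorisation-uniqueˡ {m} {n} {a} {a′} {b} {b′} coprime a∣m a′∣m b∣n b′∣n eq =
  ∣-antisym (factor-∣ a b a′ b′ a∣m b′∣n eq) (factor-∣ a′ b′ a b a′∣m b∣n (sym eq))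
  where
  factor-∣ : ∀ x y x′ y′ → x ∣ m → y′ ∣ n → x *ℕ y ≡ x′ *ℕ y′ → x ∣ x′
  factor-∣ x y x′ y′ x∣m y′∣n e =
    coprime-divisor (coprime-∣ coprime x∣m y′∣n) (subst (x ∣_) (trans e (ℕ.*-comm x′ y′)) (m∣m*n y))

coprime-factorisation-unique : Coprime m n → a ∣ m → a′ ∣ m → b ∣ n → b′ ∣ n →
  a *ℕ b ≡ a′ *ℕ b′ → a ≡ a′ × b ≡ b′
coprime-factorisation-unique {a = a} {a′} {b} {b′} coprime a∣m a′∣m b∣n b′∣n eq =
  coprime-factorisation-uniqueˡ coprime a∣m a′∣m b∣n b′∣n eq ,
  coprime-factorisation-uniqueˡ (Coprimality.sym coprime) b∣n b′∣n a∣m a′∣m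
    (trans (ℕ.*-comm b a) (trans eq (ℕ.*-comm a′ b′)))

divisors-*-↭ : .{{NonZero m}} → .{{NonZero n}} → Coprime m n →
  divisors (m *ℕ n) ↭ cartesianProductWith _*ℕ_ (divisors m) (divisors n)
divisors-*-↭ {m} {n} coprime =
  ∼bag⇒↭ (unique∧set⇒bag (divisors-unique (m *ℕ n)) products-unique (mk⇔ to from))
  where
  instance
    mn≢0 : NonZero (m *ℕ n)
    mn≢0 = ℕ.m*n≢0 m n
  to : d ∈ divisors (m *ℕ n) → d ∈ cartesianProductWith _*ℕ_ (divisors m) (divisors n)
  to d∈ with a , b , a∣m , b∣n , refl ← ∣*-split (proj₁ (∈-divisors⁻ (m *ℕ n) d∈)) =
    ∈-cartesianProductWith⁺ _*ℕ_ (∈-divisors⁺ m a∣m) (∈-divisors⁺ n b∣n)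
  from : d ∈ cartesianProductWith _*ℕ_ (divisors m) (divisors n) → d ∈ divisors (m *ℕ n)
  from d∈ with a , b , a∈ , b∈ , refl ← ∈-cartesianProductWith⁻ _*ℕ_ (divisors m) (divisors n) d∈ =
    ∈-divisors⁺ (m *ℕ n) (*-pres-∣ (proj₁ (∈-divisors⁻ m a∈)) (proj₁ (∈-divisors⁻ n b∈)))
  products-unique : Unique (cartesianProductWith _*ℕ_ (divisors m) (divisors n))
  products-unique = Unique-cartesianProductWith⁺-∈ _*ℕ_
    (λ a∈ a′∈ b∈ b′∈ → coprime-factorisation-unique coprime (∣m a∈) (∣m a′∈) (∣n b∈) (∣n b′∈))
    (divisors-unique m) (divisors-unique n)
    where
    ∣m : a ∈ divisors m → a ∣ m
    ∣m = proj₁ ∘ ∈-divisors⁻ m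
    ∣n : b ∈ divisors n → b ∣ n
    ∣n = proj₁ ∘ ∈-divisors⁻ n

Multiplicative : (ℕ → ℤ) → Set
Multiplicative F = (m n : ℕ) → NonZero m → NonZero n → Coprime m n → F (m *ℕ n) ≡ F m * F n

divisorSum : (ℕ → ℤ) → ℕ → ℤ
divisorSum F n = sumℤ (map F (divisors n))

divisorSum-multiplicative : ∀ {F} → Multiplicative F → Multiplicative (divisorSum F)
divisorSum-multiplicative {F} F-mult m n m≢0 n≢0 coprime = begin
  sumℤ (map F (divisors (m *ℕ n)))
    ≡⟨ sumℤ-↭ (Perm.map⁺ F (divisors-*-↭ {m = m} {n = n} {{m≢0}} {{n≢0}} coprime)) ⟩
  sumℤ (map F (cartesianProductWith _*ℕ_ (divisors m) (divisors n)))
    ≡⟨ sumℤ-cartesianProductWith _*ℕ_ F F F (divisors m) (divisors n) F-mult-divisors ⟩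
  divisorSum F m * divisorSum F n ∎
  where
  open ≡-Reasoning
  F-mult-divisors : a ∈ divisors m → b ∈ divisors n → F (a *ℕ b) ≡ F a * F b
  F-mult-divisors a∈ b∈ with a∣m , a≢0 ← ∈-divisors⁻ m a∈ | b∣n , b≢0 ← ∈-divisors⁻ n b∈ =
    F-mult _ _ a≢0 b≢0 (coprime-∣ coprime a∣m b∣n)

*-multiplicative : ∀ {F G} → Multiplicative F → Multiplicative G → Multiplicative (λ k → F k * G k)
*-multiplicative {F} {G} F-mult G-mult m n m≢0 n≢0 coprime =
  trans (cong₂ _*_ (F-mult m n m≢0 n≢0 coprime) (G-mult m n m≢0 n≢0 coprime)) (interchange (F m) (F n) (G m) (G n))

cube-multiplicative : Multiplicative (λ k → (+ k) ^ 3)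
cube-multiplicative m n _ _ _ = trans (cong (_^ 3) (ℤ.pos-* m n)) (^-distrib-* (+ m) (+ n) 3)

ε : ℕ → ℤ
ε k = - sgn k

εOfParity : Parity → ℤ
εOfParity 0ℙ = -1ℤ
εOfParity 1ℙ = 1ℤ

sgn-suc-suc : ∀ k → sgn (suc (suc k)) ≡ sgn k
sgn-suc-suc k = begin
  -1ℤ * (-1ℤ * sgn k) ≡⟨ ℤ.-1*i≡-i (-1ℤ * sgn k) ⟩
  - (-1ℤ * sgn k)     ≡⟨ cong -_ (ℤ.-1*i≡-i (sgn k)) ⟩
  - - sgn k           ≡⟨ ℤ.neg-involutive (sgn k) ⟩
  sgn k               ∎
  where open ≡-Reasoning

ε≡εOfParity∘parity : ∀ k → ε k ≡ εOfParity (parity k)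
ε≡εOfParity∘parity zero          = refl
ε≡εOfParity∘parity (suc zero)    = refl
ε≡εOfParity∘parity (suc (suc k)) = trans (cong -_ (sgn-suc-suc k)) (ε≡εOfParity∘parity k)

εOfParity-* : ∀ p q → p ≡ 1ℙ ⊎ q ≡ 1ℙ → εOfParity (p *ℙ q) ≡ εOfParity p * εOfParity q
εOfParity-* 0ℙ 0ℙ (inj₁ ())
εOfParity-* 0ℙ 0ℙ (inj₂ ())
εOfParity-* 0ℙ 1ℙ _ = refl
εOfParity-* 1ℙ 0ℙ _ = refl
εOfParity-* 1ℙ 1ℙ _ = refl

parity≡0ℙ⇒2∣ : ∀ n → parity n ≡ 0ℙ → 2 ∣ n
parity≡0ℙ⇒2∣ zero          _    = 2 ∣0
parity≡0ℙ⇒2∣ (suc zero)    ()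
parity≡0ℙ⇒2∣ (suc (suc n)) even = ∣m∣n⇒∣m+n ∣-refl (parity≡0ℙ⇒2∣ n even)

coprime⇒odd⊎odd : Coprime m n → parity m ≡ 1ℙ ⊎ parity n ≡ 1ℙ
coprime⇒odd⊎odd {m} {n} coprime with parity m in pm | parity n in pn
... | 1ℙ | _  = inj₁ refl
... | 0ℙ | 1ℙ = inj₂ refl
... | 0ℙ | 0ℙ with () ← coprime (parity≡0ℙ⇒2∣ m pm , parity≡0ℙ⇒2∣ n pn)

ε-multiplicative : Multiplicative ε
ε-multiplicative m n _ _ coprime = begin
  ε (m *ℕ n)                                        ≡⟨ ε≡εOfParity∘parity (m *ℕ n) ⟩
  εOfParity (parity (m *ℕ n))                       ≡⟨ cong εOfParity (Parity.*-homo-* m n) ⟩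
  εOfParity (parity m *ℙ parity n)                  ≡⟨ εOfParity-* _ _ (coprime⇒odd⊎odd coprime) ⟩
  εOfParity (parity m) * εOfParity (parity n)       ≡⟨ cong₂ _*_ (ε≡εOfParity∘parity m) (ε≡εOfParity∘parity n) ⟨
  ε m * ε n                                         ∎
  where open ≡-Reasoning

εCube : ℕ → ℤ
εCube d = ε d * (+ d) ^ 3

εCube-multiplicative : Multiplicative εCube
εCube-multiplicative = *-multiplicative {F = ε} {G = λ k → (+ k) ^ 3} ε-multiplicative cube-multiplicative

g≡ε*divisorSum : ∀ n → g n ≡ ε n * divisorSum εCube n
g≡ε*divisorSum n = begin
  sgn n * sumℤ (map (λ d → sgn d * (+ d) ^ 3) (divisors n))
    ≡⟨ cong (sgn n *_) (sumℤ-map-*ˡ _ εCube -1ℤ (divisors n) (λ {d} _ → sgn-flip (sgn d) ((+ d) ^ 3))) ⟩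
  sgn n * (-1ℤ * divisorSum εCube n)
    ≡⟨ move-1 (sgn n) (divisorSum εCube n) ⟩
  ε n * divisorSum εCube n ∎
  where
  open ≡-Reasoning
  sgn-flip : ∀ s x → s * x ≡ -1ℤ * (- s * x)
  sgn-flip = solve-∀
  move-1 : ∀ s x → s * (-1ℤ * x) ≡ - s * x
  move-1 = solve-∀

lemma2p1 : (m n : ℕ) → NonZero m → NonZero n → Coprime m n →
    g (m *ℕ n) ≡ g m * g n
lemma2p1 m n m≢0 n≢0 coprime = begin
  g (m *ℕ n)                                           ≡⟨ g≡ε*divisorSum (m *ℕ n) ⟩
  ε (m *ℕ n) * divisorSum εCube (m *ℕ n)               ≡⟨ ε*divisorSum-multiplicative m n m≢0 n≢0 coprime ⟩
  ε m * divisorSum εCube m * (ε n * divisorSum εCube n) ≡⟨ cong₂ _*_ (g≡ε*divisorSum m) (g≡ε*divisorSum n) ⟨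
  g m * g n                                            ∎
  where
  open ≡-Reasoning
  ε*divisorSum-multiplicative : Multiplicative (λ k → ε k * divisorSum εCube k)
  ε*divisorSum-multiplicative = *-multiplicative {F = ε} {G = divisorSum εCube}
    ε-multiplicative (divisorSum-multiplicative εCube-multiplicative)
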